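{- Let $d\ge2$ and $\mathbb{F}$ a field. The map from the set of $\approx$-equivalence classes in $VF_d(\mathbb{F})$ to $VF_{d-2}(\mathbb{F})$ sending the class of $f$ to $w(f)$ (which is well defined) is a bijection.
   Context: $\Delta_n=\{(r,s,t)\in\mathbb{N}^3:r+s+t=n\}$ and $VF_n(\mathbb{F})$ is the set of functions $\Delta_n\to\mathbb{F}\setminus\{0\}$. Matrices are indexed by $0,\dots,d$; $T[i,j]$ is the submatrix with rows $0,\dots,j-i$ and columns $i,\dots,j$; $T$ is very good if every $T[i,j]$ ($0\le i\le j\le d$) is invertible. $\mathcal{T}_d(\mathbb{F})$ is the set of very good upper triangular matrices; $D:\mathcal{T}_d(\mathbb{F})\to VF_d(\mathbb{F})$, $D(T)((r,s,t))=\det T[t,d-r]$, is a bijection. $T\sim T'$ iff $T'=HTK$ for invertible diagonal $H,K$, and $f\approx f'$ in $VF_d(\mathbb{F})$ iff $D^{ -1}(f)\sim D^{ -1}(f')$. For $f\in VF_d(\mathbb{F})$, $w(f)\in VF_{d-2}(\mathbb{F})$ sends $(r,s,t)$ to $\frac{f(\mu+\alpha)f(\mu+\beta)f(\mu+\gamma)}{f(\mu-\alpha)f(\mu-\beta)f(\mu-\gamma)}$, where $\mu=(r+1,s,t+1)$, $\alpha=(1,-1,0)$, $\beta=(0,1,-1)$, $\gamma=(-1,0,1)$, and $f(\lambda)$ is interpreted as $1$ for $\lambda\in\mathbb{Z}^3\setminus\Delta_d$. -}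

module Defs where

open import Level using (Level; _⊔_; suc)
open import Algebra.Bundles using (CommutativeRing)
open import Data.Nat as ℕ using (ℕ; zero; _≤_; _<_; _∸_)
  renaming (_+_ to _+ℕ_; suc to sucℕ)
open import Data.Nat.Properties using () renaming (_≟_ to _≟ℕ_)
import Data.Integer
open import Data.Integer using (ℤ; +_; -[1+_])
import Data.Fin
open import Data.Fin using (Fin; toℕ; punchIn) renaming (zero to fzero; suc to fsuc)
open import Data.Product using (Σ; ∃; _×_; _,_; proj₁; proj₂)
open import Relation.Nullary using (¬_; yes; no)
open import Relation.Binary.PropositionalEquality using (_≡_)

-- A field: a commutative ring with 1 ≠ 0 in which every nonzero element
-- has a multiplicative inverse (inverse given as a total function, only
-- constrained on nonzero elements).
record Field (c ℓ : Level) : Set (Level.suc (c ⊔ ℓ)) where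
  field
    commutativeRing : CommutativeRing c ℓ
  open CommutativeRing commutativeRing public
  field
    _⁻¹       : Carrier → Carrier
    1≉0       : ¬ (1# ≈ 0#)
    inverseʳ  : ∀ x → ¬ (x ≈ 0#) → (x * (x ⁻¹)) ≈ 1#

module FieldDefs {c ℓ : Level} (𝔽 : Field c ℓ) where
  open Field 𝔽 public

  Mat : ℕ → Set c
  Mat n = Fin n → Fin n → Carrier

  ∑ : ∀ {n} → (Fin n → Carrier) → Carrier
  ∑ {zero}   f = 0#
  ∑ {sucℕ n} f = f fzero + ∑ (λ j → f (fsuc j))

  det : ∀ {n} → Mat n → Carrier
  det {zero}   M = 1#
  det {sucℕ n} M = ∑ (λ j → sign j * (M fzero j * det (minor j)))
    where
      sign : ∀ {m} → Fin m → Carrier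
      sign fzero    = 1#
      sign (fsuc j) = - sign j
      minor : Fin (sucℕ n) → Mat n
      minor j a b = M (fsuc a) (punchIn j b)

  -- entries of a (d+1)×(d+1) matrix (indices 0,…,d) addressed by naturals;
  -- out-of-range entries are never used below
  entry : ∀ {d} → Mat (sucℕ d) → ℕ → ℕ → Carrier
  entry {d} T a b with a ℕ.<? sucℕ d | b ℕ.<? sucℕ d
  ... | yes a< | yes b< = T (Data.Fin.fromℕ< a<) (Data.Fin.fromℕ< b<)
  ... | _      | _      = 0#

  -- T[i,j]: rows 0,…,j-i and columns i,…,j
  sub : ∀ {d} → Mat (sucℕ d) → (i j : ℕ) → Mat (sucℕ (j ∸ i))
  sub T i j a b = entry T (toℕ a) (i +ℕ toℕ b)

  UpperTriangular : ∀ {d} → Mat (sucℕ d) → Set ℓ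
  UpperTriangular T = ∀ a b → toℕ b < toℕ a → T a b ≈ 0#

  VeryGood : ∀ {d} → Mat (sucℕ d) → Set ℓ
  VeryGood {d} T = ∀ i j → i ≤ j → j ≤ d → ¬ (det (sub T i j) ≈ 0#)

  𝒯 : ℕ → Set (c ⊔ ℓ)
  𝒯 d = Σ (Mat (sucℕ d)) (λ T → UpperTriangular T × VeryGood T)

  record Δ (n : ℕ) : Set where
    constructor ⟨_,_,_∣_⟩
    field
      r s t : ℕ
      sum≡  : r +ℕ s +ℕ t ≡ n

  VF : ℕ → Set (c ⊔ ℓ)
  VF n = Σ (Δ n → Carrier) (λ f → ∀ x → ¬ (f x ≈ 0#))

  _≗Δ_ : ∀ {n} → (Δ n → Carrier) → (Δ n → Carrier) → Set ℓ
  f ≗Δ g = ∀ x → f x ≈ g x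

  D : ∀ {d} → Mat (sucℕ d) → Δ d → Carrier
  D {d} T ⟨ r , s , t ∣ _ ⟩ = det (sub T t (d ∸ r))

  -- T ∼ T' iff T' = H T K for invertible diagonal H, K
  -- (H, K given by their diagonals, whose entries are nonzero)
  _∼_ : ∀ {d} → Mat (sucℕ d) → Mat (sucℕ d) → Set (c ⊔ ℓ)
  _∼_ {d} T T' = Σ (Fin (sucℕ d) → Carrier) λ H → Σ (Fin (sucℕ d) → Carrier) λ K →
    (∀ a → ¬ (H a ≈ 0#)) × (∀ a → ¬ (K a ≈ 0#)) ×
    (∀ a b → T' a b ≈ (H a * T a b) * K b)

  -- f ≈ f' iff D⁻¹(f) ∼ D⁻¹(f'), i.e. the (unique) very good upper
  -- triangular preimages of f and f' under D are ∼-related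
  _≈VF_ : ∀ {d} → VF d → VF d → Set (c ⊔ ℓ)
  _≈VF_ {d} f f' = Σ (𝒯 d) λ T → Σ (𝒯 d) λ T' →
    (D (proj₁ T) ≗Δ proj₁ f) × (D (proj₁ T') ≗Δ proj₁ f') × (proj₁ T ∼ proj₁ T')

  -- f(λ) for λ ∈ ℤ³, interpreted as 1 outside Δ_d
  ext : ∀ {d} → (Δ d → Carrier) → ℤ → ℤ → ℤ → Carrier
  ext {d} f (+ r) (+ s) (+ t) with r +ℕ s +ℕ t ≟ℕ d
  ... | yes p = f ⟨ r , s , t ∣ p ⟩
  ... | no _  = 1#
  ext f _ _ _ = 1#

  -- w(f) ∈ VF_{d-2}, with μ = (r+1,s,t+1), α=(1,-1,0), β=(0,1,-1), γ=(-1,0,1)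
  w : ∀ {d} → (Δ d → Carrier) → Δ (d ∸ 2) → Carrier
  w f ⟨ r , s , t ∣ _ ⟩ =
      ((F (μr Data.Integer.+ + 1) (μs Data.Integer.- + 1) μt
         * F μr (μs Data.Integer.+ + 1) (μt Data.Integer.- + 1))
         * F (μr Data.Integer.- + 1) μs (μt Data.Integer.+ + 1))
    * (((F (μr Data.Integer.- + 1) (μs Data.Integer.+ + 1) μt
         * F μr (μs Data.Integer.- + 1) (μt Data.Integer.+ + 1))
         * F (μr Data.Integer.+ + 1) μs (μt Data.Integer.- + 1)) ⁻¹)
    where
      F = ext f
      μr = + (sucℕ r)
      μs = + s
      μt = + (sucℕ t)

-- Write ψ n t for the n × n minor of T in rows 0 … n-1 and columns t … t+n-1, so that
-- f(r,s,t) = ψ (s+1) t and ψ 0 t = 1.  Then w(f)(r,s,t) is the hexagon ratio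
--   ψ s (t+1) · ψ (s+2) t · ψ (s+1) (t+2) / (ψ (s+2) (t+1) · ψ s (t+2) · ψ (s+1) t).
-- Replacing T by H T K multiplies ψ n t by (h₀ ⋯ h_{n-1}) (k_t ⋯ k_{t+n-1}); these factors cancel in
-- every hexagon ratio, so w is well defined.  Conversely, the ratio at (n, t) determines the corner
-- ψ (n+2) (t+1) from minors that are smaller or further left, so ψ is determined by its ratios
-- together with its values on the row n = 1 and the column t = 0.  A diagonal scaling can match any
-- such boundary values, which gives injectivity; prescribing the ratios and putting 1 on the boundary
-- gives surjectivity.  Injectivity also needs every f to be D T for a very good T: det is affine in
-- the bottom-right entry with slope the next smaller minor, so T can be filled in entry by entry.
module Submission where

open import Defs
open import Data.Nat using (ℕ; _≤_; _∸_)
open import Data.Product using (Σ; _×_; proj₁)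
open import Relation.Nullary using (¬_)

open import Data.Nat using (zero; suc; _<_; _<?_; _≤?_; z≤n; s≤s; s≤s⁻¹) renaming (_+_ to _+ℕ_)
import Data.Nat.Properties as ℕ
open import Data.Nat.Tactic.RingSolver using () renaming (solve to solve-ℕ)
open import Data.Fin using (Fin; toℕ; fromℕ; fromℕ<; inject₁; punchIn)
  renaming (zero to fzero; suc to fsuc)
import Data.Fin.Properties as Fin
import Data.Integer as ℤ
open import Data.List using (List; _∷_; [])
open import Data.Product using (_,_; proj₂)
open import Data.Sum using (_⊎_; inj₁; inj₂)
open import Relation.Nullary using (yes; no; contradiction)
import Relation.Binary.PropositionalEquality as ≡
open ≡ using (_≡_)

punchIn-inject₁ : ∀ {n} (i : Fin (suc n)) (j : Fin n) →
  punchIn (inject₁ i) (inject₁ j) ≡ inject₁ (punchIn i j)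
punchIn-inject₁ fzero    j        = ≡.refl
punchIn-inject₁ (fsuc i) fzero    = ≡.refl
punchIn-inject₁ (fsuc i) (fsuc j) = ≡.cong fsuc (punchIn-inject₁ i j)

punchIn-inject₁-fromℕ : ∀ {n} (i : Fin (suc n)) → punchIn (inject₁ i) (fromℕ n) ≡ fromℕ (suc n)
punchIn-inject₁-fromℕ {zero}  fzero    = ≡.refl
punchIn-inject₁-fromℕ {suc n} fzero    = ≡.refl
punchIn-inject₁-fromℕ {suc n} (fsuc i) = ≡.cong fsuc (punchIn-inject₁-fromℕ i)

punchIn-fromℕ : ∀ {n} (j : Fin n) → punchIn (fromℕ n) j ≡ inject₁ j
punchIn-fromℕ fzero    = ≡.refl
punchIn-fromℕ (fsuc j) = ≡.cong fsuc (punchIn-fromℕ j)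

s+t≤d : ∀ {d} r s t → r +ℕ s +ℕ t ≡ d → s +ℕ t ≤ d
s+t≤d r s t p = ≡.subst (s +ℕ t ≤_) (≡.trans (≡.sym (ℕ.+-assoc r s t)) p) (ℕ.m≤n+m (s +ℕ t) r)

r≡d∸[s+t] : ∀ {d} r s t → r +ℕ s +ℕ t ≡ d → r ≡ d ∸ (s +ℕ t)
r≡d∸[s+t] r s t p = ≡.trans (≡.sym (ℕ.m+n∸n≡m r (s +ℕ t)))
                             (≡.cong (_∸ (s +ℕ t)) (≡.trans (≡.sym (ℕ.+-assoc r s t)) p))

d∸r∸t≡s : ∀ {d} r s t → r +ℕ s +ℕ t ≡ d → d ∸ r ∸ t ≡ s
d∸r∸t≡s r s t p = ≡.trans (≡.cong (_∸ t) d∸r≡s+t) (ℕ.m+n∸n≡m s t)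
  where
  d∸r≡s+t : _ ∸ r ≡ s +ℕ t
  d∸r≡s+t = ≡.trans (≡.cong (_∸ r) (≡.trans (≡.sym p) (ℕ.+-assoc r s t))) (ℕ.m+n∸m≡n r (s +ℕ t))

d∸[s+t]+s+t≡d : ∀ {d} s t → s +ℕ t ≤ d → d ∸ (s +ℕ t) +ℕ s +ℕ t ≡ d
d∸[s+t]+s+t≡d s t s+t≤d = ≡.trans (ℕ.+-assoc _ s t) (ℕ.m∸n+n≡m s+t≤d)

module _ {c ℓ} (𝔽 : Field c ℓ) where
  open FieldDefs 𝔽
  open import Relation.Binary.Reasoning.Setoid setoid
  open import Algebra.Solver.Ring.NaturalCoefficients.Default commutativeSemiring
    using (solve; _:=_; _:*_; _:+_)
  open import Algebra.Properties.AbelianGroup +-abelianGroup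
    using (//-rightDividesˡ; //-rightDividesʳ; x≈y⇒x∙y⁻¹≈ε; xyx⁻¹≈y)
  open import Algebra.Properties.Semiring.Sum semiring
    using (sum; sum-cong-≋; sum-init-last; *-distribˡ-sum; ∑-distrib-+)
  open import Algebra.Properties.CommutativeMonoid.Sum *-commutativeMonoid
    using () renaming (sum to ∏; sum-cong-≗ to ∏-cong-≡; sum-remove to ∏-remove;
                       sum-init-last to ∏-init-last)

  -- Field arithmetic

  _/_ : Carrier → Carrier → Carrier
  x / y = x * y ⁻¹
  infixl 7 _/_

  inverseˡ : ∀ {x} → x ≉ 0# → x ⁻¹ * x ≈ 1#
  inverseˡ {x} x≉0 = trans (*-comm _ _) (inverseʳ x x≉0)

  *-nonzero : ∀ {x y} → x ≉ 0# → y ≉ 0# → x * y ≉ 0#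
  *-nonzero {x} {y} x≉0 y≉0 xy≈0 = y≉0 (begin
    y              ≈⟨ *-identityˡ y ⟨
    1# * y         ≈⟨ *-congʳ (inverseˡ x≉0) ⟨
    x ⁻¹ * x * y   ≈⟨ *-assoc _ _ _ ⟩
    x ⁻¹ * (x * y) ≈⟨ *-congˡ xy≈0 ⟩
    x ⁻¹ * 0#      ≈⟨ zeroʳ _ ⟩
    0#             ∎)

  ⁻¹-nonzero : ∀ {x} → x ≉ 0# → x ⁻¹ ≉ 0#
  ⁻¹-nonzero {x} x≉0 x⁻¹≈0 = 1≉0 (begin
    1#       ≈⟨ inverseʳ x x≉0 ⟨
    x * x ⁻¹ ≈⟨ *-congˡ x⁻¹≈0 ⟩
    x * 0#   ≈⟨ zeroʳ x ⟩
    0#       ∎)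

  /-nonzero : ∀ {x y} → x ≉ 0# → y ≉ 0# → x / y ≉ 0#
  /-nonzero x≉0 y≉0 = *-nonzero x≉0 (⁻¹-nonzero y≉0)

  ≉0-resp-≈ : ∀ {x y} → x ≈ y → x ≉ 0# → y ≉ 0#
  ≉0-resp-≈ x≈y x≉0 y≈0 = x≉0 (trans x≈y y≈0)

  x/y*y≈x : ∀ {x y} → y ≉ 0# → x / y * y ≈ x
  x/y*y≈x {x} {y} y≉0 = begin
    x * y ⁻¹ * y   ≈⟨ *-assoc _ _ _ ⟩
    x * (y ⁻¹ * y) ≈⟨ *-congˡ (inverseˡ y≉0) ⟩
    x * 1#         ≈⟨ *-identityʳ x ⟩
    x              ∎

  x*y≈z⇒x≈z/y : ∀ {x y z} → y ≉ 0# → x * y ≈ z → x ≈ z / y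
  x*y≈z⇒x≈z/y {x} {y} {z} y≉0 xy≈z = begin
    x              ≈⟨ *-identityʳ x ⟨
    x * 1#         ≈⟨ *-congˡ (inverseʳ y y≉0) ⟨
    x * (y * y ⁻¹) ≈⟨ *-assoc _ _ _ ⟨
    x * y * y ⁻¹   ≈⟨ *-congʳ xy≈z ⟩
    z / y          ∎

  ⁻¹-cong : ∀ {x y} → x ≉ 0# → x ≈ y → x ⁻¹ ≈ y ⁻¹
  ⁻¹-cong {x} {y} x≉0 x≈y = trans
    (x*y≈z⇒x≈z/y (≉0-resp-≈ x≈y x≉0) (trans (*-congˡ (sym x≈y)) (inverseˡ x≉0)))
    (*-identityˡ _)

  /-cong : ∀ {x x′ y y′} → y ≉ 0# → x ≈ x′ → y ≈ y′ → x / y ≈ x′ / y′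
  /-cong y≉0 x≈x′ y≈y′ = *-cong x≈x′ (⁻¹-cong y≉0 y≈y′)

  [g*x]/[g*y]≈x/y : ∀ {g x y} → g ≉ 0# → y ≉ 0# → (g * x) / (g * y) ≈ x / y
  [g*x]/[g*y]≈x/y {g} {x} {y} g≉0 y≉0 = sym (x*y≈z⇒x≈z/y (*-nonzero g≉0 y≉0) (begin
    x / y * (g * y) ≈⟨ solve 3 (λ q g y → q :* (g :* y) := g :* (q :* y)) refl (x / y) g y ⟩
    g * (x / y * y) ≈⟨ *-congˡ (x/y*y≈x y≉0) ⟩
    g * x           ∎))

  x*[y/[x*z]*z]≈y : ∀ {x y z} → x ≉ 0# → z ≉ 0# → x * (y / (x * z) * z) ≈ y
  x*[y/[x*z]*z]≈y {x} {y} {z} x≉0 z≉0 = begin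
    x * (y / (x * z) * z) ≈⟨ solve 3 (λ q x z → x :* (q :* z) := q :* (x :* z)) refl (y / (x * z)) x z ⟩
    y / (x * z) * (x * z) ≈⟨ x/y*y≈x (*-nonzero x≉0 z≉0) ⟩
    y                     ∎

  x/[y*a*b]≈h⇒y≈x/[h*a*b] : ∀ {x y a b h} → x ≉ 0# → y ≉ 0# → a ≉ 0# → b ≉ 0# →
    x / (y * a * b) ≈ h → y ≈ x / (h * a * b)
  x/[y*a*b]≈h⇒y≈x/[h*a*b] {x} {y} {a} {b} {h} x≉0 y≉0 a≉0 b≉0 x/yab≈h =
    x*y≈z⇒x≈z/y (*-nonzero (*-nonzero h≉0 a≉0) b≉0) (begin
      y * (h * a * b)
        ≈⟨ solve 4 (λ y h a b → y :* (h :* a :* b) := h :* (y :* a :* b)) refl y h a b ⟩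
      h * (y * a * b)               ≈⟨ *-congʳ x/yab≈h ⟨
      x / (y * a * b) * (y * a * b) ≈⟨ x/y*y≈x yab≉0 ⟩
      x                             ∎)
    where
    yab≉0 : y * a * b ≉ 0#
    yab≉0 = *-nonzero (*-nonzero y≉0 a≉0) b≉0
    h≉0 : h ≉ 0#
    h≉0 = ≉0-resp-≈ x/yab≈h (/-nonzero x≉0 yab≉0)

  ∏-nonzero : ∀ {n} (f : Fin n → Carrier) → (∀ j → f j ≉ 0#) → ∏ f ≉ 0#
  ∏-nonzero {zero}  f f≉0 = 1≉0
  ∏-nonzero {suc n} f f≉0 =
    *-nonzero (f≉0 fzero) (∏-nonzero (λ j → f (fsuc j)) (λ j → f≉0 (fsuc j)))

  -- Determinants

  ∑≡sum : ∀ {n} (f : Fin n → Carrier) → ∑ f ≡ sum f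
  ∑≡sum {zero}  f = ≡.refl
  ∑≡sum {suc n} f = ≡.cong (f fzero +_) (∑≡sum (λ j → f (fsuc j)))

  -- sum-cong-≋ with explicit vectors: they cannot be inferred once the length is a successor,
  -- because sum then unfolds.
  sum-cong : ∀ {n} (f g : Fin n → Carrier) → (∀ j → f j ≈ g j) → sum f ≈ sum g
  sum-cong f g = sum-cong-≋

  -- The cofactor signs of det are local to its where-block.  Unification recovers them here, and
  -- since det never uses its matrix argument in them, Agda identifies them with the signs inside
  -- det of every matrix.
  private
    signOfDet : Σ (∀ {m} → Fin m → Carrier) λ σ → ∀ m →
      det {suc m} (λ _ _ → 0#)
        ≡ 1# * (0# * det {m} (λ _ _ → 0#)) + ∑ {m} (λ j → (- σ {m} j) * (0# * det {m} (λ _ _ → 0#)))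
    signOfDet = _ , λ _ → ≡.refl

  sign : ∀ {m} → Fin m → Carrier
  sign = proj₁ signOfDet

  sign-inject₁ : ∀ {m} (j : Fin m) → sign (inject₁ j) ≡ sign j
  sign-inject₁ fzero    = ≡.refl
  sign-inject₁ (fsuc j) = ≡.cong -_ (sign-inject₁ j)

  minor : ∀ {n} → Mat (suc n) → Fin (suc n) → Mat n
  minor M j a b = M (fsuc a) (punchIn j b)

  expansion : ∀ {n} → Mat (suc n) → Fin (suc n) → Carrier
  expansion M j = sign j * (M fzero j * det (minor M j))

  laplace : ∀ {n} (M : Mat (suc n)) → det M ≡ sum (expansion M)
  laplace M = ∑≡sum (expansion M)

  det-cong : ∀ {n} {M N : Mat n} → (∀ a b → M a b ≈ N a b) → det M ≈ det N
  det-cong {zero}  M≈N = refl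
  det-cong {suc n} {M} {N} M≈N = begin
    det M             ≡⟨ laplace M ⟩
    sum (expansion M) ≈⟨ sum-cong (expansion M) (expansion N) (λ j →
                           *-congˡ (*-cong (M≈N fzero j) (det-cong (λ a b → M≈N (fsuc a) (punchIn j b))))) ⟩
    sum (expansion N) ≡⟨ laplace N ⟨
    det N             ∎

  det-scale : ∀ {n} (h k : Fin n → Carrier) (M : Mat n) →
    det (λ a b → h a * M a b * k b) ≈ (∏ h * ∏ k) * det M
  det-scale {zero}  h k M = sym (trans (*-identityʳ _) (*-identityʳ _))
  det-scale {suc n} h k M = begin
    det M′                                  ≡⟨ laplace M′ ⟩
    sum (expansion M′)                      ≈⟨ sum-cong _ (λ j → (∏ h * ∏ k) * expansion M j) term ⟩
    sum (λ j → (∏ h * ∏ k) * expansion M j) ≈⟨ *-distribˡ-sum (∏ h * ∏ k) (expansion M) ⟨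
    (∏ h * ∏ k) * sum (expansion M)         ≡⟨ ≡.cong ((∏ h * ∏ k) *_) (laplace M) ⟨
    (∏ h * ∏ k) * det M                     ∎
    where
    M′ : Mat (suc n)
    M′ a b = h a * M a b * k b
    term : ∀ j → expansion M′ j ≈ (∏ h * ∏ k) * expansion M j
    term j = begin
      sign j * (h fzero * M fzero j * k j * det (minor M′ j))
        ≈⟨ *-congˡ (*-congˡ (det-scale (λ a → h (fsuc a)) (λ b → k (punchIn j b)) (minor M j))) ⟩
      sign j * (h fzero * M fzero j * k j * ((H′ * K′) * Δ₀))
        ≈⟨ solve 7 (λ s h₀ m kⱼ H′ K′ D → s :* (h₀ :* m :* kⱼ :* ((H′ :* K′) :* D))
                                          := (h₀ :* H′ :* (kⱼ :* K′)) :* (s :* (m :* D)))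
                   refl (sign j) (h fzero) (M fzero j) (k j) H′ K′ Δ₀ ⟩
      (∏ h * (k j * K′)) * (sign j * (M fzero j * Δ₀))
        ≈⟨ *-congʳ (*-congˡ (∏-remove k)) ⟨
      (∏ h * ∏ k) * expansion M j ∎
      where
      H′ K′ Δ₀ : Carrier
      H′ = ∏ (λ a → h (fsuc a))
      K′ = ∏ (λ b → k (punchIn j b))
      Δ₀ = det (minor M j)

  topLeft : ∀ {m} → Mat (suc m) → Mat m
  topLeft M a b = M (inject₁ a) (inject₁ b)

  corner : ∀ {m} → Mat (suc m) → Carrier
  corner {m} M = M (fromℕ m) (fromℕ m)

  -- det M is affine in corner M with slope det (topLeft M); this is its constant term.
  detOffCorner : ∀ {m} → Mat (suc m) → Carrier
  detOffCorner M = det M - corner M * det (topLeft M)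

  det≈detOffCorner+corner*det : ∀ {m} (M : Mat (suc m)) →
    det M ≈ detOffCorner M + corner M * det (topLeft M)
  det≈detOffCorner+corner*det M = sym (//-rightDividesˡ (corner M * det (topLeft M)) (det M))

  AgreeOffCorner : ∀ {m} → Mat (suc m) → Mat (suc m) → Set ℓ
  AgreeOffCorner M N = (∀ a b → M (inject₁ a) b ≈ N (inject₁ a) b)
                     × (∀ a b → M a (inject₁ b) ≈ N a (inject₁ b))

  offCornerExpansion : ∀ {m} → Mat (suc (suc m)) → Fin (suc m) → Carrier
  offCornerExpansion M k = sign k * (M fzero (inject₁ k) * detOffCorner (minor M (inject₁ k)))

  detOffCorner-laplace : ∀ {m} (M : Mat (suc (suc m))) →
    detOffCorner M ≈ sum (offCornerExpansion M) + expansion M (fromℕ (suc m))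
  detOffCorner-laplace {m} M = begin
    det M - y * X                                   ≡⟨ ≡.cong (_- y * X) (laplace M) ⟩
    sum (expansion M) - y * X                       ≈⟨ +-congʳ (sum-init-last (expansion M)) ⟩
    sum (λ k → expansion M (inject₁ k)) + L - y * X
      ≈⟨ +-congʳ (+-congʳ (sum-cong _ (λ k → offCornerExpansion M k + y * expansion (topLeft M) k) split)) ⟩
    sum (λ k → offCornerExpansion M k + y * expansion (topLeft M) k) + L - y * X
      ≈⟨ +-congʳ (+-congʳ (∑-distrib-+ (offCornerExpansion M) (λ k → y * expansion (topLeft M) k))) ⟩
    sum (offCornerExpansion M) + sum (λ k → y * expansion (topLeft M) k) + L - y * X
      ≈⟨ +-congʳ (+-congʳ (+-congˡ (*-distribˡ-sum y (expansion (topLeft M))))) ⟨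
    sum (offCornerExpansion M) + y * sum (expansion (topLeft M)) + L - y * X
      ≡⟨ ≡.cong (λ z → sum (offCornerExpansion M) + y * z + L - y * X) (laplace (topLeft M)) ⟨
    sum (offCornerExpansion M) + y * X + L - y * X
      ≈⟨ +-congʳ (solve 3 (λ a b l → a :+ b :+ l := a :+ l :+ b) refl _ (y * X) L) ⟩
    sum (offCornerExpansion M) + L + y * X - y * X  ≈⟨ //-rightDividesʳ (y * X) _ ⟩
    sum (offCornerExpansion M) + L                  ∎
    where
    y X L : Carrier
    y = corner M
    X = det (topLeft M)
    L = expansion M (fromℕ (suc m))
    split : ∀ k → expansion M (inject₁ k) ≈ offCornerExpansion M k + y * expansion (topLeft M) k
    split k = begin
      sign (inject₁ k) * (M fzero (inject₁ k) * det (minor M (inject₁ k)))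
        ≈⟨ *-cong (reflexive (sign-inject₁ k)) (*-congˡ (det≈detOffCorner+corner*det M̃)) ⟩
      sign k * (M fzero (inject₁ k) * (D₀ + corner M̃ * det (topLeft M̃)))
        ≈⟨ *-congˡ (*-congˡ (+-congˡ (*-cong (reflexive (≡.cong (M _) (punchIn-inject₁-fromℕ k)))
                                             (det-cong λ a b →
                                                reflexive (≡.cong (M _) (punchIn-inject₁ k b)))))) ⟩
      sign k * (M fzero (inject₁ k) * (D₀ + y * det (minor (topLeft M) k)))
        ≈⟨ solve 5 (λ s m D y X → s :* (m :* (D :+ y :* X)) := s :* (m :* D) :+ y :* (s :* (m :* X)))
                   refl (sign k) (M fzero (inject₁ k)) D₀ y (det (minor (topLeft M) k)) ⟩
      offCornerExpansion M k + y * expansion (topLeft M) k ∎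
      where
      M̃ : Mat (suc m)
      M̃ = minor M (inject₁ k)
      D₀ : Carrier
      D₀ = detOffCorner M̃

  detOffCorner-1×1 : (M : Mat 1) → detOffCorner M ≈ 0#
  detOffCorner-1×1 M = x≈y⇒x∙y⁻¹≈ε (trans (+-identityʳ _) (*-identityˡ _))

  detOffCorner-cong : ∀ {m} {M N : Mat (suc m)} → AgreeOffCorner M N → detOffCorner M ≈ detOffCorner N
  detOffCorner-cong {zero}  {M} {N} _ = trans (detOffCorner-1×1 M) (sym (detOffCorner-1×1 N))
  detOffCorner-cong {suc m} {M} {N} (rows≈ , cols≈) = begin
    detOffCorner M                                           ≈⟨ detOffCorner-laplace M ⟩
    sum (offCornerExpansion M) + expansion M (fromℕ (suc m))
      ≈⟨ +-cong (sum-cong (offCornerExpansion M) (offCornerExpansion N) λ k →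
                   *-congˡ (*-cong (rows≈ fzero _)
                                   (detOffCorner-cong {M = minor M (inject₁ k)} {N = minor N (inject₁ k)}
                                                      (minors-agree k))))
                (*-congˡ (*-cong (rows≈ fzero _) (det-cong last-minor≈))) ⟩
    sum (offCornerExpansion N) + expansion N (fromℕ (suc m)) ≈⟨ detOffCorner-laplace N ⟨
    detOffCorner N                                           ∎
    where
    minors-agree : ∀ k → AgreeOffCorner (minor M (inject₁ k)) (minor N (inject₁ k))
    minors-agree k = (λ a b → rows≈ (fsuc a) _)
                   , (λ a b → ≡.subst (λ j → M (fsuc a) j ≈ N (fsuc a) j)
                                      (≡.sym (punchIn-inject₁ k b)) (cols≈ (fsuc a) (punchIn k b)))
    last-minor≈ : ∀ a b → minor M (fromℕ (suc m)) a b ≈ minor N (fromℕ (suc m)) a b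
    last-minor≈ a b =
      ≡.subst (λ j → M (fsuc a) j ≈ N (fsuc a) j) (≡.sym (punchIn-fromℕ b)) (cols≈ (fsuc a) b)

  -- Initial minors of ℕ-indexed arrays

  window : (ℕ → ℕ → Carrier) → (n t : ℕ) → Mat n
  window A n t a b = A (toℕ a) (t +ℕ toℕ b)

  windowDet : (ℕ → ℕ → Carrier) → ℕ → ℕ → Carrier
  windowDet A n t = det (window A n t)

  prodFrom : (ℕ → Carrier) → ℕ → ℕ → Carrier
  prodFrom k t n = ∏ (λ (b : Fin n) → k (t +ℕ toℕ b))

  prodFrom-suc : ∀ k t n → prodFrom k t (suc n) ≈ k t * prodFrom k (suc t) n
  prodFrom-suc k t n = *-cong (reflexive (≡.cong k (ℕ.+-identityʳ t)))
                              (reflexive (∏-cong-≡ {n} (λ b → ≡.cong k (ℕ.+-suc t (toℕ b)))))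

  prodFrom-snoc : ∀ k t n → prodFrom k t (suc n) ≈ prodFrom k t n * k (t +ℕ n)
  prodFrom-snoc k t n = trans (∏-init-last (λ b → k (t +ℕ toℕ b)))
    (*-cong (reflexive (∏-cong-≡ {n} (λ b → ≡.cong (λ i → k (t +ℕ i)) (Fin.toℕ-inject₁ b))))
            (reflexive (≡.cong (λ i → k (t +ℕ i)) (Fin.toℕ-fromℕ n))))

  gauge : (ℕ → Carrier) → (ℕ → Carrier) → ℕ → ℕ → Carrier
  gauge h k n t = prodFrom h 0 n * prodFrom k t n

  windowDet-scale : ∀ {A A′ : ℕ → ℕ → Carrier} (h k : ℕ → Carrier) →
    (∀ x y → A′ x y ≈ h x * A x y * k y) →
    ∀ n t → windowDet A′ n t ≈ gauge h k n t * windowDet A n t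
  windowDet-scale {A} h k A′≈ n t =
    trans (det-cong {n} (λ a b → A′≈ (toℕ a) (t +ℕ toℕ b)))
          (det-scale (λ a → h (toℕ a)) (λ b → k (t +ℕ toℕ b)) (window A n t))

  -- Hexagon ratios

  NonVanishing : (ℕ → ℕ → Carrier) → Set ℓ
  NonVanishing ψ = ∀ n t → ψ n t ≉ 0#

  hexNum hexDen hex : (ℕ → ℕ → Carrier) → ℕ → ℕ → Carrier
  hexNum ψ n t = ψ n (suc t) * ψ (suc (suc n)) t * ψ (suc n) (suc (suc t))
  hexDen ψ n t = ψ (suc (suc n)) (suc t) * ψ n (suc (suc t)) * ψ (suc n) t
  hex ψ n t = hexNum ψ n t / hexDen ψ n t

  hexNum-nonzero : ∀ {ψ} → NonVanishing ψ → ∀ n t → hexNum ψ n t ≉ 0#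
  hexNum-nonzero ψ≉0 n t = *-nonzero (*-nonzero (ψ≉0 _ _) (ψ≉0 _ _)) (ψ≉0 _ _)

  hexDen-nonzero : ∀ {ψ} → NonVanishing ψ → ∀ n t → hexDen ψ n t ≉ 0#
  hexDen-nonzero ψ≉0 n t = *-nonzero (*-nonzero (ψ≉0 _ _) (ψ≉0 _ _)) (ψ≉0 _ _)

  hex-nonzero : ∀ {ψ} → NonVanishing ψ → ∀ n t → hex ψ n t ≉ 0#
  hex-nonzero ψ≉0 n t = /-nonzero (hexNum-nonzero ψ≉0 n t) (hexDen-nonzero ψ≉0 n t)

  gauge-nonVanishing : ∀ {h k} → (∀ x → h x ≉ 0#) → (∀ x → k x ≉ 0#) → NonVanishing (gauge h k)
  gauge-nonVanishing {h} {k} h≉0 k≉0 n t =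
    *-nonzero (∏-nonzero {n} (λ a → h (toℕ a)) (λ _ → h≉0 _))
              (∏-nonzero {n} (λ b → k (t +ℕ toℕ b)) (λ _ → k≉0 _))

  hexNum-gauge≈hexDen-gauge : ∀ h k n t → hexNum (gauge h k) n t ≈ hexDen (gauge h k) n t
  hexNum-gauge≈hexDen-gauge h k n t = begin
    u n * Q n (suc t) * (u (2 +ℕ n) * Q (2 +ℕ n) t) * (u (1 +ℕ n) * Q (1 +ℕ n) (2 +ℕ t))
      ≈⟨ *-cong (*-congˡ (*-congˡ (trans (prodFrom-suc k t (suc n))
                                         (*-congˡ (prodFrom-suc k (suc t) n)))))
                (*-congˡ (prodFrom-snoc k (2 +ℕ t) n)) ⟩
    u n * Q n (suc t) * (u (2 +ℕ n) * (k t * (k (suc t) * Q n (2 +ℕ t))))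
      * (u (1 +ℕ n) * (Q n (2 +ℕ t) * k (2 +ℕ t +ℕ n)))
      ≈⟨ solve 8 (λ u₀ u₁ u₂ a b k₀ k₁ z →
                    u₀ :* a :* (u₂ :* (k₀ :* (k₁ :* b))) :* (u₁ :* (b :* z))
                    := u₂ :* (k₁ :* (b :* z)) :* (u₀ :* b) :* (u₁ :* (k₀ :* a)))
                 refl (u n) (u (1 +ℕ n)) (u (2 +ℕ n)) (Q n (suc t)) (Q n (2 +ℕ t))
                      (k t) (k (suc t)) (k (2 +ℕ t +ℕ n)) ⟩
    u (2 +ℕ n) * (k (suc t) * (Q n (2 +ℕ t) * k (2 +ℕ t +ℕ n))) * (u n * Q n (2 +ℕ t))
      * (u (1 +ℕ n) * (k t * Q n (suc t)))
      ≈⟨ *-cong (*-congʳ (*-congˡ (trans (prodFrom-suc k (suc t) (suc n))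
                                         (*-congˡ (prodFrom-snoc k (2 +ℕ t) n)))))
                (*-congˡ (prodFrom-suc k t n)) ⟨
    u (2 +ℕ n) * Q (2 +ℕ n) (suc t) * (u n * Q n (2 +ℕ t)) * (u (1 +ℕ n) * Q (1 +ℕ n) t) ∎
    where
    u : ℕ → Carrier
    u n = prodFrom h 0 n
    Q : ℕ → ℕ → Carrier
    Q n t = prodFrom k t n

  hex-gauge : ∀ {g ψ} → NonVanishing g → NonVanishing ψ → (∀ n t → hexNum g n t ≈ hexDen g n t) →
    ∀ n t → hex (λ n t → g n t * ψ n t) n t ≈ hex ψ n t
  hex-gauge {g} {ψ} g≉0 ψ≉0 balanced n t = begin
    hex (λ n t → g n t * ψ n t) n t
      ≈⟨ /-cong (hexDen-nonzero (λ n t → *-nonzero (g≉0 n t) (ψ≉0 n t)) n t) interchange interchange ⟩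
    (hexNum g n t * hexNum ψ n t) / (hexDen g n t * hexDen ψ n t)
      ≈⟨ *-congʳ (*-congʳ (balanced n t)) ⟩
    (hexDen g n t * hexNum ψ n t) / (hexDen g n t * hexDen ψ n t)
      ≈⟨ [g*x]/[g*y]≈x/y (hexDen-nonzero g≉0 n t) (hexDen-nonzero ψ≉0 n t) ⟩
    hex ψ n t ∎
    where
    interchange : ∀ {a b c x y z} → a * x * (b * y) * (c * z) ≈ a * b * c * (x * y * z)
    interchange {a} {b} {c} {x} {y} {z} =
      solve 6 (λ a b c x y z → a :* x :* (b :* y) :* (c :* z) := a :* b :* c :* (x :* y :* z))
              refl a b c x y z

  hex-corner : ∀ {ψ} → NonVanishing ψ → ∀ n t →
    ψ (suc (suc n)) (suc t) ≈ hexNum ψ n t / (hex ψ n t * ψ n (suc (suc t)) * ψ (suc n) t)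
  hex-corner ψ≉0 n t =
    x/[y*a*b]≈h⇒y≈x/[h*a*b] (hexNum-nonzero ψ≉0 n t) (ψ≉0 _ _) (ψ≉0 _ _) (ψ≉0 _ _) refl

  -- φ (n+2) (t+1) is the corner of the hexagon at (n, t), whose other vertices precede it
  -- lexicographically; hence the recursion below.
  hex-unique : ∀ m {φ φ′} → NonVanishing φ → NonVanishing φ′ →
    (∀ t → φ 0 t ≈ φ′ 0 t) → (∀ t → φ 1 t ≈ φ′ 1 t) →
    (∀ n → φ (suc n) 0 ≈ φ′ (suc n) 0) →
    (∀ n t → n +ℕ t ≤ m → hex φ n t ≈ hex φ′ n t) →
    ∀ n t → n +ℕ t ≤ 3 +ℕ m → φ n t ≈ φ′ n t
  hex-unique m {φ} {φ′} φ≉0 φ′≉0 row₀ row₁ column₀ hex≈ = go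
    where
    go : ∀ n t → n +ℕ t ≤ 3 +ℕ m → φ n t ≈ φ′ n t
    go zero          t       _  = row₀ t
    go (suc zero)    t       _  = row₁ t
    go (suc (suc n)) zero    _  = column₀ (suc n)
    go (suc (suc n)) (suc t) le = begin
      φ (2 +ℕ n) (1 +ℕ t)                                        ≈⟨ hex-corner φ≉0 n t ⟩
      hexNum φ n t / (hex φ n t * φ n (2 +ℕ t) * φ (1 +ℕ n) t)
        ≈⟨ /-cong (*-nonzero (*-nonzero (hex-nonzero φ≉0 n t) (φ≉0 _ _)) (φ≉0 _ _))
             (*-cong (*-cong (go n (suc t) (within (ℕ.m≤n+m _ 2)))
                             (go (suc (suc n)) t (within (s≤s (s≤s n+t≤n+1+t)))))
                     (go (suc n) (suc (suc t)) (within (ℕ.≤-reflexive (≡.cong suc n+2+t≡1+n+1+t)))))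
             (*-cong (*-cong (hex≈ n t n+t≤m)
                             (go n (suc (suc t))
                                 (within (ℕ.≤-trans (ℕ.≤-reflexive n+2+t≡1+n+1+t) (ℕ.n≤1+n _)))))
                     (go (suc n) t (within (s≤s (ℕ.≤-trans n+t≤n+1+t (ℕ.n≤1+n _)))))) ⟩
      hexNum φ′ n t / (hex φ′ n t * φ′ n (2 +ℕ t) * φ′ (1 +ℕ n) t) ≈⟨ hex-corner φ′≉0 n t ⟨
      φ′ (2 +ℕ n) (1 +ℕ t)                                       ∎
      where
      within : ∀ {x} → x ≤ 2 +ℕ (n +ℕ suc t) → x ≤ 3 +ℕ m
      within x≤ = ℕ.≤-trans x≤ le
      n+t≤m : n +ℕ t ≤ m
      n+t≤m = s≤s⁻¹ (≡.subst (_≤ suc m) (ℕ.+-suc n t) (s≤s⁻¹ (s≤s⁻¹ le)))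
      n+t≤n+1+t : n +ℕ t ≤ n +ℕ suc t
      n+t≤n+1+t = ℕ.+-monoʳ-≤ n (ℕ.n≤1+n t)
      n+2+t≡1+n+1+t : n +ℕ suc (suc t) ≡ suc (n +ℕ suc t)
      n+2+t≡1+n+1+t = ℕ.+-suc n (suc t)

  module HexSolution (γ : ℕ → ℕ → Carrier) (γ≉0 : NonVanishing γ) where
    F : ℕ → ℕ → Carrier
    F zero          t       = 1#
    F (suc zero)    t       = 1#
    F (suc (suc n)) zero    = 1#
    F (suc (suc n)) (suc t) = F n (suc t) * F (suc (suc n)) t * F (suc n) (suc (suc t))
                            / (γ n t * F n (suc (suc t)) * F (suc n) t)

    F-nonVanishing : NonVanishing F
    F-nonVanishing zero          t       = 1≉0
    F-nonVanishing (suc zero)    t       = 1≉0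
    F-nonVanishing (suc (suc n)) zero    = 1≉0
    F-nonVanishing (suc (suc n)) (suc t) =
      /-nonzero (*-nonzero (*-nonzero (F-nonVanishing n (suc t)) (F-nonVanishing (suc (suc n)) t))
                           (F-nonVanishing (suc n) (suc (suc t))))
                (*-nonzero (*-nonzero (γ≉0 n t) (F-nonVanishing n (suc (suc t))))
                           (F-nonVanishing (suc n) t))

    hex-F : ∀ n t → hex F n t ≈ γ n t
    hex-F n t = sym (x/[y*a*b]≈h⇒y≈x/[h*a*b] (hexNum-nonzero F-nonVanishing n t) (γ≉0 n t)
                      (F-nonVanishing n (suc (suc t))) (F-nonVanishing (suc n) t) refl)

  -- Minor tables of functions on Δ

  -- ψ (suc s) t is f(r,s,t), the minor of size s+1 on columns t … t+s; ψ 0 t is the empty minor.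
  record Represents {d} (f : Δ d → Carrier) (ψ : ℕ → ℕ → Carrier) : Set ℓ where
    field
      empty≈1 : ∀ t → ψ 0 t ≈ 1#
      f≈ψ     : ∀ r s t (p : r +ℕ s +ℕ t ≡ d) → f ⟨ r , s , t ∣ p ⟩ ≈ ψ (suc s) t

  ext≈ : ∀ {d} {f : Δ d → Carrier} {ψ} → Represents f ψ →
    ∀ r s t {s′ t′} → r +ℕ s +ℕ t ≡ d → s ≡ s′ → t ≡ t′ →
    ext f (ℤ.+ r) (ℤ.+ s) (ℤ.+ t) ≈ ψ (suc s′) t′
  ext≈ {d} rep r s t p ≡.refl ≡.refl with r +ℕ s +ℕ t ℕ.≟ d
  ... | yes q  = Represents.f≈ψ rep r s t q
  ... | no q≢p = contradiction p q≢p

  ext-pred≈ : ∀ {d} {f : Δ d → Carrier} {ψ} → Represents f ψ →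
    ∀ r s t {t′} → r +ℕ s +ℕ t ≡ suc d → t ≡ t′ →
    ext f (ℤ.+ r) (ℤ.+ s ℤ.- ℤ.+ 1) (ℤ.+ t) ≈ ψ s t′
  ext-pred≈ rep r zero    t _ ≡.refl = sym (Represents.empty≈1 rep t)
  ext-pred≈ rep r (suc s) t p t≡t′   =
    ext≈ rep r s t (ℕ.suc-injective (≡.trans (≡.cong (_+ℕ t) (≡.sym (ℕ.+-suc r s))) p)) ≡.refl t≡t′

  w≈hex : ∀ {e} {f : Δ (2 +ℕ e) → Carrier} {ψ} → NonVanishing ψ → Represents f ψ →
    ∀ r s t (p : r +ℕ s +ℕ t ≡ e) → w f ⟨ r , s , t ∣ p ⟩ ≈ hex ψ s t
  w≈hex {e} ψ≉0 rep r s t p = sym (/-cong (hexDen-nonzero ψ≉0 s t)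
    (sym (*-cong (*-cong (ext-pred≈ rep (suc r +ℕ 1) s (suc t) (shifted 3 (solve-ℕ rst)) ≡.refl)
                         (ext≈ rep (suc r) (s +ℕ 1) t (shifted 2 (solve-ℕ rst)) (ℕ.+-comm s 1) ≡.refl))
                 (ext≈ rep r s (suc t +ℕ 1) (shifted 2 (solve-ℕ rst)) ≡.refl (ℕ.+-comm (suc t) 1))))
    (sym (*-cong (*-cong (ext≈ rep r (s +ℕ 1) (suc t) (shifted 2 (solve-ℕ rst)) (ℕ.+-comm s 1) ≡.refl)
                         (ext-pred≈ rep (suc r) s (suc t +ℕ 1) (shifted 3 (solve-ℕ rst)) (ℕ.+-comm (suc t) 1)))
                 (ext≈ rep (suc r +ℕ 1) s t (shifted 2 (solve-ℕ rst)) ≡.refl ≡.refl))))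
    where
    rst : List ℕ
    rst = r ∷ s ∷ t ∷ []
    shifted : ∀ k {x} → x ≡ k +ℕ (r +ℕ s +ℕ t) → x ≡ k +ℕ e
    shifted k x≡ = ≡.trans x≡ (≡.cong (k +ℕ_) p)

  Δ-≡ : ∀ {d r r′ s t} (p : r +ℕ s +ℕ t ≡ d) (p′ : r′ +ℕ s +ℕ t ≡ d) → r ≡ r′ →
    ⟨ r , s , t ∣ p ⟩ ≡ ⟨ r′ , s , t ∣ p′ ⟩
  Δ-≡ p p′ ≡.refl = ≡.cong ⟨ _ , _ , _ ∣_⟩ (ℕ.≡-irrelevant p p′)

  minorTable : ∀ {d} → (Δ d → Carrier) → ℕ → ℕ → Carrier
  minorTable     f zero    t = 1#
  minorTable {d} f (suc s) t with s +ℕ t ≤? d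
  ... | yes s+t≤d = f ⟨ d ∸ (s +ℕ t) , s , t ∣ d∸[s+t]+s+t≡d s t s+t≤d ⟩
  ... | no  _     = 1#

  f≈minorTable : ∀ {d} (f : Δ d → Carrier) r s t (p : r +ℕ s +ℕ t ≡ d) →
    f ⟨ r , s , t ∣ p ⟩ ≈ minorTable f (suc s) t
  f≈minorTable {d} f r s t p with s +ℕ t ≤? d
  ... | yes _     = reflexive (≡.cong f (Δ-≡ _ _ (r≡d∸[s+t] r s t p)))
  ... | no  s+t≰d = contradiction (s+t≤d r s t p) s+t≰d

  minorTable-represents : ∀ {d} (f : Δ d → Carrier) → Represents f (minorTable f)
  minorTable-represents f = record { empty≈1 = λ _ → refl ; f≈ψ = f≈minorTable f }

  minorTable-nonVanishing : ∀ {d} (f : Δ d → Carrier) → (∀ x → f x ≉ 0#) → NonVanishing (minorTable f)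
  minorTable-nonVanishing     f f≉0 zero    t = 1≉0
  minorTable-nonVanishing {d} f f≉0 (suc s) t with s +ℕ t ≤? d
  ... | yes _ = f≉0 _
  ... | no  _ = 1≉0

  D≡windowDet : ∀ {d} (T : Mat (suc d)) r s t (p : r +ℕ s +ℕ t ≡ d) →
    D T ⟨ r , s , t ∣ p ⟩ ≡ windowDet (entry T) (suc s) t
  D≡windowDet T r s t p = ≡.cong (λ n → windowDet (entry T) (suc n) t) (d∸r∸t≡s r s t p)

  -- Reconstructing a very good matrix from its initial minors

  module Reconstruction (d : ℕ) (ψ : ℕ → ℕ → Carrier) (ψ≉0 : NonVanishing ψ)
                        (ψ₀≈1 : ∀ t → ψ 0 t ≈ 1#) where

    update : (ℕ → ℕ → Carrier) → ℕ → ℕ → Carrier → ℕ → ℕ → Carrier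
    update B a c v i j with i ℕ.≟ a | j ℕ.≟ c
    ... | yes _ | yes _ = v
    ... | _     | _     = B i j

    -- The entry at (a, c) that gives the window of size a+1 with corner (a, c) the determinant
    -- ψ (a+1) (c-a); only the entries of B off that corner are used.
    entryFor : (ℕ → ℕ → Carrier) → ℕ → ℕ → Carrier
    entryFor B a c with a ≤? c
    ... | yes _ = (ψ (suc a) (c ∸ a) - detOffCorner (window B (suc a) (c ∸ a))) / ψ a (c ∸ a)
    ... | no  _ = 0#

    -- filled a c holds the final entries at all positions before (a, c) in row-major order on the
    -- columns 0 … d.  Splitting on c first makes the first clause compute for a variable a.
    filled : ℕ → ℕ → ℕ → ℕ → Carrier
    filled a       (suc c) = update (filled a c) a c (entryFor (filled a c) a c)
    filled (suc a) zero    = filled a (suc d)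
    filled zero    zero    = λ _ _ → 0#

    A : ℕ → ℕ → Carrier
    A a c = entryFor (filled a c) a c

    filled-stable : ∀ a c i j → j ≤ d → i < a ⊎ (i ≡ a × j < c) → filled a c i j ≡ A i j
    filled-stable zero    zero    i j _   (inj₁ ())
    filled-stable zero    zero    i j _   (inj₂ (_ , ()))
    filled-stable (suc a) zero    i j _   (inj₂ (_ , ()))
    filled-stable (suc a) zero    i j j≤d (inj₁ i<1+a) with ℕ.m≤n⇒m<n∨m≡n (s≤s⁻¹ i<1+a)
    ... | inj₁ i<a = filled-stable a (suc d) i j j≤d (inj₁ i<a)
    ... | inj₂ i≡a = filled-stable a (suc d) i j j≤d (inj₂ (i≡a , s≤s j≤d))
    filled-stable a (suc c) i j j≤d before with i ℕ.≟ a | j ℕ.≟ c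
    ... | yes ≡.refl | yes ≡.refl = ≡.refl
    ... | yes ≡.refl | no j≢c     = filled-stable a c i j j≤d (inj₂ (≡.refl , j<c before))
      where
      j<c : i < i ⊎ (i ≡ i × j < suc c) → j < c
      j<c (inj₁ i<i)         = contradiction i<i (ℕ.<-irrefl ≡.refl)
      j<c (inj₂ (_ , j<1+c)) = ℕ.≤∧≢⇒< (s≤s⁻¹ j<1+c) j≢c
    ... | no i≢a | _ = filled-stable a c i j j≤d (inj₁ (i<a before))
      where
      i<a : i < a ⊎ (i ≡ a × j < suc c) → i < a
      i<a (inj₁ i<a)       = i<a
      i<a (inj₂ (i≡a , _)) = contradiction i≡a i≢a

    A-lower : ∀ a c → c < a → A a c ≡ 0#
    A-lower a c c<a with a ≤? c
    ... | yes a≤c = contradiction a≤c (ℕ.<⇒≱ c<a)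
    ... | no  _   = ≡.refl

    A-corner : ∀ a t → A a (t +ℕ a) ≡
      (ψ (suc a) t - detOffCorner (window (filled a (t +ℕ a)) (suc a) t)) / ψ a t
    A-corner a t with a ≤? t +ℕ a
    ... | yes _     =
      ≡.cong (λ u → (ψ (suc a) u - detOffCorner (window B (suc a) u)) / ψ a u) (ℕ.m+n∸n≡m t a)
      where
      B : ℕ → ℕ → Carrier
      B = filled a (t +ℕ a)
    ... | no  a≰t+a = contradiction (ℕ.m≤n+m a t) a≰t+a

    window-agrees-off-corner : ∀ a t → t +ℕ a ≤ d →
      AgreeOffCorner (window A (suc a) t) (window (filled a (t +ℕ a)) (suc a) t)
    window-agrees-off-corner a t t+a≤d = rows , columns
      where
      column≤d : ∀ (j : Fin (suc a)) → t +ℕ toℕ j ≤ d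
      column≤d j = ℕ.≤-trans (ℕ.+-monoʳ-≤ t (Fin.toℕ≤pred[n] j)) t+a≤d
      B : ℕ → ℕ → Carrier
      B = filled a (t +ℕ a)
      rows : ∀ i j → window A (suc a) t (inject₁ i) j ≈ window B (suc a) t (inject₁ i) j
      rows i j = reflexive (≡.sym (filled-stable a (t +ℕ a) _ _ (column≤d j) (inj₁ (Fin.inject₁ℕ< i))))
      columns : ∀ i j → window A (suc a) t i (inject₁ j) ≈ window B (suc a) t i (inject₁ j)
      columns i j = reflexive (≡.sym (filled-stable a (t +ℕ a) _ _ (column≤d (inject₁ j)) before))
        where
        before : toℕ i < a ⊎ (toℕ i ≡ a × t +ℕ toℕ (inject₁ j) < t +ℕ a)
        before with ℕ.m≤n⇒m<n∨m≡n (Fin.toℕ≤pred[n] i)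
        ... | inj₁ i<a = inj₁ i<a
        ... | inj₂ i≡a = inj₂ (i≡a , ℕ.+-monoʳ-< t (Fin.inject₁ℕ< j))

    windowDet-A : ∀ n t → n +ℕ t ≤ suc d → windowDet A n t ≈ ψ n t
    windowDet-A zero    t _  = sym (ψ₀≈1 t)
    windowDet-A (suc a) t le = begin
      det W                                       ≈⟨ det≈detOffCorner+corner*det W ⟩
      detOffCorner W + corner W * det (topLeft W)
        ≈⟨ +-cong (detOffCorner-cong {M = W} {N = window (filled a (t +ℕ a)) (suc a) t}
                                     (window-agrees-off-corner a t t+a≤d))
                  (*-cong (reflexive (≡.cong₂ A′ (Fin.toℕ-fromℕ a) (Fin.toℕ-fromℕ a)))
                          (trans (det-cong {a} λ i j →
                                    reflexive (≡.cong₂ A′ (Fin.toℕ-inject₁ i) (Fin.toℕ-inject₁ j)))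
                                 (windowDet-A a t (ℕ.≤-trans (ℕ.n≤1+n _) le)))) ⟩
      D₀ + A a (t +ℕ a) * ψ a t                   ≡⟨ ≡.cong (λ x → D₀ + x * ψ a t) (A-corner a t) ⟩
      D₀ + (ψ (suc a) t - D₀) / ψ a t * ψ a t     ≈⟨ +-congˡ (x/y*y≈x (ψ≉0 a t)) ⟩
      D₀ + (ψ (suc a) t - D₀)                     ≈⟨ +-assoc _ _ _ ⟨
      D₀ + ψ (suc a) t - D₀                       ≈⟨ xyx⁻¹≈y D₀ _ ⟩
      ψ (suc a) t                                 ∎
      where
      A′ : ℕ → ℕ → Carrier
      A′ x y = A x (t +ℕ y)
      W : Mat (suc a)
      W = window A (suc a) t
      D₀ : Carrier
      D₀ = detOffCorner (window (filled a (t +ℕ a)) (suc a) t)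
      t+a≤d : t +ℕ a ≤ d
      t+a≤d = ≡.subst (_≤ d) (ℕ.+-comm a t) (s≤s⁻¹ le)

    T : Mat (suc d)
    T a b = A (toℕ a) (toℕ b)

    entry-T : ∀ x y → x < suc d → y < suc d → entry T x y ≡ A x y
    entry-T x y x<1+d y<1+d with x <? suc d | y <? suc d
    ... | yes p  | yes q  = ≡.cong₂ A (Fin.toℕ-fromℕ< p) (Fin.toℕ-fromℕ< q)
    ... | no  ¬p | _      = contradiction x<1+d ¬p
    ... | yes _  | no  ¬q = contradiction y<1+d ¬q

    windowDet-T : ∀ n t → n +ℕ t ≤ suc d → windowDet (entry T) n t ≈ ψ n t
    windowDet-T n t le =
      trans (det-cong {n} λ a b → reflexive (entry-T _ _ (row< a) (column< b))) (windowDet-A n t le)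
      where
      row< : ∀ (a : Fin n) → toℕ a < suc d
      row< a = ℕ.<-≤-trans (Fin.toℕ<n a) (ℕ.≤-trans (ℕ.m≤m+n n t) le)
      column< : ∀ (b : Fin n) → t +ℕ toℕ b < suc d
      column< b = ℕ.<-≤-trans (ℕ.+-monoʳ-< t (Fin.toℕ<n b)) (≡.subst (_≤ suc d) (ℕ.+-comm n t) le)

    T-upperTriangular : UpperTriangular T
    T-upperTriangular a b b<a = reflexive (A-lower (toℕ a) (toℕ b) b<a)

    T-veryGood : VeryGood T
    T-veryGood i j i≤j j≤d det≈0 =
      ψ≉0 (suc (j ∸ i)) i (trans (sym (windowDet-T (suc (j ∸ i)) i in-range)) det≈0)
      where
      in-range : suc (j ∸ i) +ℕ i ≤ suc d
      in-range = s≤s (ℕ.≤-trans (ℕ.≤-reflexive (ℕ.m∸n+n≡m i≤j)) j≤d)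

  D-surjective : ∀ {d} (f : VF d) → Σ (𝒯 d) (λ T → D (proj₁ T) ≗Δ proj₁ f)
  D-surjective {d} (f , f≉0) = (T , T-upperTriangular , T-veryGood) , DT≗f
    where
    open Reconstruction d (minorTable f) (minorTable-nonVanishing f f≉0) (λ _ → refl)
    DT≗f : D T ≗Δ f
    DT≗f ⟨ r , s , t ∣ p ⟩ = begin
      D T ⟨ r , s , t ∣ p ⟩          ≡⟨ D≡windowDet T r s t p ⟩
      windowDet (entry T) (suc s) t  ≈⟨ windowDet-T (suc s) t (s≤s (s+t≤d r s t p)) ⟩
      minorTable f (suc s) t         ≈⟨ f≈minorTable f r s t p ⟨
      f ⟨ r , s , t ∣ p ⟩            ∎

  -- Diagonal scaling

  extend : ∀ {d} → (Fin (suc d) → Carrier) → ℕ → Carrier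
  extend {d} H x with x <? suc d
  ... | yes x<1+d = H (fromℕ< x<1+d)
  ... | no  _     = 1#

  extend-toℕ : ∀ {d} (H : Fin (suc d) → Carrier) a → extend H (toℕ a) ≡ H a
  extend-toℕ {d} H a with toℕ a <? suc d
  ... | yes a<1+d = ≡.cong H (Fin.fromℕ<-toℕ a a<1+d)
  ... | no  a≮1+d = contradiction (Fin.toℕ<n a) a≮1+d

  extend-nonzero : ∀ {d} {H : Fin (suc d) → Carrier} → (∀ a → H a ≉ 0#) → ∀ x → extend H x ≉ 0#
  extend-nonzero {d} H≉0 x with x <? suc d
  ... | yes _ = H≉0 _
  ... | no  _ = 1≉0

  entry-scale : ∀ {d} {T T′ : Mat (suc d)} (h k : ℕ → Carrier) →
    (∀ a b → T′ a b ≈ h (toℕ a) * T a b * k (toℕ b)) →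
    ∀ x y → entry T′ x y ≈ h x * entry T x y * k y
  entry-scale {d} {T} {T′} h k T′≈ x y with x <? suc d | y <? suc d
  ... | yes p | yes q =
    ≡.subst₂ (λ u v → T′ a b ≈ h u * T a b * k v) (Fin.toℕ-fromℕ< p) (Fin.toℕ-fromℕ< q) (T′≈ a b)
    where
    a b : Fin (suc d)
    a = fromℕ< p
    b = fromℕ< q
  ... | yes _ | no  _ = sym (trans (*-congʳ (zeroʳ _)) (zeroˡ _))
  ... | no  _ | _     = sym (trans (*-congʳ (zeroʳ _)) (zeroˡ _))

  module Scaling {d} {T T′ : Mat (suc d)} (h k : ℕ → Carrier)
                 (h≉0 : ∀ x → h x ≉ 0#) (k≉0 : ∀ x → k x ≉ 0#)
                 (T′≈hTk : ∀ a b → T′ a b ≈ h (toℕ a) * T a b * k (toℕ b)) where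

    windowDet-scaled : ∀ n t → windowDet (entry T′) n t ≈ gauge h k n t * windowDet (entry T) n t
    windowDet-scaled = windowDet-scale h k (entry-scale h k T′≈hTk)

    D-scaled : ∀ r s t (p : r +ℕ s +ℕ t ≡ d) →
      D T′ ⟨ r , s , t ∣ p ⟩ ≈ gauge h k (suc s) t * D T ⟨ r , s , t ∣ p ⟩
    D-scaled r s t p = begin
      D T′ ⟨ r , s , t ∣ p ⟩                              ≡⟨ D≡windowDet T′ r s t p ⟩
      windowDet (entry T′) (suc s) t                      ≈⟨ windowDet-scaled (suc s) t ⟩
      gauge h k (suc s) t * windowDet (entry T) (suc s) t ≈⟨ *-congˡ (reflexive (D≡windowDet T r s t p)) ⟨
      gauge h k (suc s) t * D T ⟨ r , s , t ∣ p ⟩         ∎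

    scaled-upperTriangular : UpperTriangular T → UpperTriangular T′
    scaled-upperTriangular T-upper a b b<a =
      trans (T′≈hTk a b) (trans (*-congʳ (trans (*-congˡ (T-upper a b b<a)) (zeroʳ _))) (zeroˡ _))

    scaled-veryGood : VeryGood T → VeryGood T′
    scaled-veryGood T-good i j i≤j j≤d =
      ≉0-resp-≈ (sym (windowDet-scaled (suc (j ∸ i)) i))
                (*-nonzero (gauge-nonVanishing h≉0 k≉0 (suc (j ∸ i)) i) (T-good i j i≤j j≤d))

  -- h 0 = 1 removes the freedom (h, k) ↦ (c h, c⁻¹ k); the rest matches ψ′ / ψ on row 1 and column 0.
  module BoundaryGauge (ψ ψ′ : ℕ → ℕ → Carrier) (ψ≉0 : NonVanishing ψ) (ψ′≉0 : NonVanishing ψ′)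
    where
    ρ : ℕ → ℕ → Carrier
    ρ n t = ψ′ n t / ψ n t

    ρ≉0 : NonVanishing ρ
    ρ≉0 n t = /-nonzero (ψ′≉0 n t) (ψ≉0 n t)

    h k : ℕ → Carrier
    h zero    = 1#
    h (suc a) = ρ (2 +ℕ a) 0 / (ρ (suc a) 0 * ρ 1 (suc a))
    k t = ρ 1 t

    h≉0 : ∀ a → h a ≉ 0#
    h≉0 zero    = 1≉0
    h≉0 (suc a) = /-nonzero (ρ≉0 _ _) (*-nonzero (ρ≉0 _ _) (ρ≉0 _ _))

    k≉0 : ∀ t → k t ≉ 0#
    k≉0 = ρ≉0 1

    gauge-row₁ : ∀ t → gauge h k 1 t * ψ 1 t ≈ ψ′ 1 t
    gauge-row₁ t = begin
      1# * 1# * (k (t +ℕ 0) * 1#) * ψ 1 t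
        ≈⟨ *-congʳ (trans (*-cong (*-identityʳ 1#) (*-identityʳ _)) (*-identityˡ _)) ⟩
      k (t +ℕ 0) * ψ 1 t                  ≡⟨ ≡.cong (λ u → k u * ψ 1 t) (ℕ.+-identityʳ t) ⟩
      ρ 1 t * ψ 1 t                       ≈⟨ x/y*y≈x (ψ≉0 1 t) ⟩
      ψ′ 1 t                              ∎

    gauge-column₀≈ρ : ∀ n → gauge h k (suc n) 0 ≈ ρ (suc n) 0
    gauge-column₀≈ρ zero    = trans (*-cong (*-identityʳ 1#) (*-identityʳ _)) (*-identityˡ _)
    gauge-column₀≈ρ (suc n) = begin
      gauge h k (2 +ℕ n) 0
        ≈⟨ *-cong (prodFrom-snoc h 0 (suc n)) (prodFrom-snoc k 0 (suc n)) ⟩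
      prodFrom h 0 (suc n) * h (suc n) * (prodFrom k 0 (suc n) * k (suc n))
        ≈⟨ solve 4 (λ u a v b → u :* a :* (v :* b) := u :* v :* (a :* b)) refl _ _ _ _ ⟩
      gauge h k (suc n) 0 * (h (suc n) * k (suc n))
        ≈⟨ *-congʳ (gauge-column₀≈ρ n) ⟩
      ρ (suc n) 0 * (ρ (2 +ℕ n) 0 / (ρ (suc n) 0 * ρ 1 (suc n)) * ρ 1 (suc n))
        ≈⟨ x*[y/[x*z]*z]≈y (ρ≉0 _ _) (ρ≉0 _ _) ⟩
      ρ (2 +ℕ n) 0 ∎

    gauge-column₀ : ∀ n → gauge h k (suc n) 0 * ψ (suc n) 0 ≈ ψ′ (suc n) 0
    gauge-column₀ n = trans (*-congʳ (gauge-column₀≈ρ n)) (x/y*y≈x (ψ≉0 _ _))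

    gauge-equivalent : ∀ m → (∀ t → ψ 0 t ≈ ψ′ 0 t) →
      (∀ n t → n +ℕ t ≤ m → hex ψ n t ≈ hex ψ′ n t) →
      ∀ n t → n +ℕ t ≤ 3 +ℕ m → gauge h k n t * ψ n t ≈ ψ′ n t
    gauge-equivalent m row₀ hex≈ = hex-unique m (λ n t → *-nonzero (g≉0 n t) (ψ≉0 n t)) ψ′≉0
      (λ t → trans (*-congʳ (*-identityʳ _)) (trans (*-identityˡ _) (row₀ t))) gauge-row₁ gauge-column₀
      (λ n t n+t≤m → trans (hex-gauge g≉0 ψ≉0 (hexNum-gauge≈hexDen-gauge h k) n t) (hex≈ n t n+t≤m))
      where
      g≉0 : NonVanishing (gauge h k)
      g≉0 = gauge-nonVanishing h≉0 k≉0

  w-respects-≈VF : ∀ e (f f′ : VF (2 +ℕ e)) → f ≈VF f′ → w (proj₁ f) ≗Δ w (proj₁ f′)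
  w-respects-≈VF e (f , f≉0) (f′ , _) ((T , _) , (T′ , _) , DT≗f , DT′≗f′ , H , K , H≉0 , K≉0 , T′≈HTK)
                 ⟨ r , s , t ∣ p ⟩ = begin
    w f ⟨ r , s , t ∣ p ⟩           ≈⟨ w≈hex ψ≉0 (minorTable-represents f) r s t p ⟩
    hex ψ s t                       ≈⟨ hex-gauge g≉0 ψ≉0 (hexNum-gauge≈hexDen-gauge h k) s t ⟨
    hex gψ s t                      ≈⟨ w≈hex gψ≉0 f′-represents r s t p ⟨
    w f′ ⟨ r , s , t ∣ p ⟩          ∎
    where
    ψ : ℕ → ℕ → Carrier
    ψ = minorTable f
    ψ≉0 : NonVanishing ψ
    ψ≉0 = minorTable-nonVanishing f f≉0
    h k : ℕ → Carrier
    h = extend H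
    k = extend K
    g : ℕ → ℕ → Carrier
    g = gauge h k
    g≉0 : NonVanishing g
    g≉0 = gauge-nonVanishing (extend-nonzero H≉0) (extend-nonzero K≉0)
    gψ : ℕ → ℕ → Carrier
    gψ n t = g n t * ψ n t
    gψ≉0 : NonVanishing gψ
    gψ≉0 n t = *-nonzero (g≉0 n t) (ψ≉0 n t)
    open Scaling h k (extend-nonzero H≉0) (extend-nonzero K≉0)
      (λ a b → ≡.subst₂ (λ u v → T′ a b ≈ u * T a b * v)
                        (≡.sym (extend-toℕ H a)) (≡.sym (extend-toℕ K b)) (T′≈HTK a b))
    f′-represents : Represents f′ gψ
    f′-represents = record
      { empty≈1 = λ _ → trans (*-identityʳ _) (*-identityʳ _)
      ; f≈ψ     = λ r s t p → begin
          f′ ⟨ r , s , t ∣ p ⟩                ≈⟨ DT′≗f′ _ ⟨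
          D T′ ⟨ r , s , t ∣ p ⟩              ≈⟨ D-scaled r s t p ⟩
          g (suc s) t * D T ⟨ r , s , t ∣ p ⟩ ≈⟨ *-congˡ (trans (DT≗f _) (f≈minorTable f r s t p)) ⟩
          g (suc s) t * ψ (suc s) t           ∎
      }

  w-nonzero : ∀ {e} (f : Δ (2 +ℕ e) → Carrier) → (∀ x → f x ≉ 0#) → ∀ x → w f x ≉ 0#
  w-nonzero f f≉0 ⟨ r , s , t ∣ p ⟩ =
    ≉0-resp-≈ (sym (w≈hex ψ≉0 (minorTable-represents f) r s t p)) (hex-nonzero ψ≉0 s t)
    where
    ψ≉0 : NonVanishing (minorTable f)
    ψ≉0 = minorTable-nonVanishing f f≉0

  w-injective : ∀ e (f f′ : VF (2 +ℕ e)) → w (proj₁ f) ≗Δ w (proj₁ f′) → f ≈VF f′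
  w-injective e (f , f≉0) (f′ , f′≉0) w≗w′ with D-surjective (f , f≉0)
  ... | 𝕋@(T , T-upper , T-veryGood) , DT≗f =
    𝕋 , (T′ , scaled-upperTriangular T-upper , scaled-veryGood T-veryGood) , DT≗f , DT′≗f′ ,
    (λ a → h (toℕ a)) , (λ b → k (toℕ b)) , (λ a → h≉0 (toℕ a)) , (λ b → k≉0 (toℕ b)) ,
    (λ _ _ → refl)
    where
    ψ ψ′ : ℕ → ℕ → Carrier
    ψ  = minorTable f
    ψ′ = minorTable f′
    ψ≉0 : NonVanishing ψ
    ψ≉0 = minorTable-nonVanishing f f≉0
    ψ′≉0 : NonVanishing ψ′
    ψ′≉0 = minorTable-nonVanishing f′ f′≉0
    open BoundaryGauge ψ ψ′ ψ≉0 ψ′≉0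
    T′ : Mat (3 +ℕ e)
    T′ a b = h (toℕ a) * T a b * k (toℕ b)
    open Scaling {T = T} {T′ = T′} h k h≉0 k≉0 (λ _ _ → refl)
    hex≈ : ∀ n t → n +ℕ t ≤ e → hex ψ n t ≈ hex ψ′ n t
    hex≈ n t n+t≤e = begin
      hex ψ n t  ≈⟨ w≈hex ψ≉0 (minorTable-represents f) _ n t q ⟨
      w f x      ≈⟨ w≗w′ x ⟩
      w f′ x     ≈⟨ w≈hex ψ′≉0 (minorTable-represents f′) _ n t q ⟩
      hex ψ′ n t ∎
      where
      q : e ∸ (n +ℕ t) +ℕ n +ℕ t ≡ e
      q = d∸[s+t]+s+t≡d n t n+t≤e
      x : Δ e
      x = ⟨ e ∸ (n +ℕ t) , n , t ∣ q ⟩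
    DT′≗f′ : D T′ ≗Δ f′
    DT′≗f′ ⟨ r , s , t ∣ p ⟩ = begin
      D T′ ⟨ r , s , t ∣ p ⟩                      ≈⟨ D-scaled r s t p ⟩
      gauge h k (suc s) t * D T ⟨ r , s , t ∣ p ⟩ ≈⟨ *-congˡ (trans (DT≗f _) (f≈minorTable f r s t p)) ⟩
      gauge h k (suc s) t * ψ (suc s) t
        ≈⟨ gauge-equivalent e (λ _ → refl) hex≈ (suc s) t (s≤s (s+t≤d r s t p)) ⟩
      ψ′ (suc s) t                                ≈⟨ f≈minorTable f′ r s t p ⟨
      f′ ⟨ r , s , t ∣ p ⟩                        ∎

  w-surjective : ∀ e (g : VF e) → Σ (VF (2 +ℕ e)) (λ f → w (proj₁ f) ≗Δ proj₁ g)
  w-surjective e (g , g≉0) = (f , λ x → F-nonVanishing (suc (Δ.s x)) (Δ.t x)) , w≗g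
    where
    open HexSolution (λ s t → minorTable g (suc s) t) (λ s t → minorTable-nonVanishing g g≉0 (suc s) t)
    f : Δ (2 +ℕ e) → Carrier
    f x = F (suc (Δ.s x)) (Δ.t x)
    f-represents : Represents f F
    f-represents = record { empty≈1 = λ _ → refl ; f≈ψ = λ _ _ _ _ → refl }
    w≗g : w f ≗Δ g
    w≗g ⟨ r , s , t ∣ p ⟩ = begin
      w f ⟨ r , s , t ∣ p ⟩  ≈⟨ w≈hex F-nonVanishing f-represents r s t p ⟩
      hex F s t              ≈⟨ hex-F s t ⟩
      minorTable g (suc s) t ≈⟨ f≈minorTable g r s t p ⟨
      g ⟨ r , s , t ∣ p ⟩    ∎

lemma8p16 : ∀ {c ℓ} (𝔽 : Field c ℓ) (d : ℕ) → 2 ≤ d →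
    let open FieldDefs 𝔽 in
    -- well defined: ≈-equivalent f, f' have the same w
    (∀ (f f' : VF d) → f ≈VF f' → w (proj₁ f) ≗Δ w (proj₁ f'))
    -- w(f) lands in VF_{d-2}
    × (∀ (f : VF d) (x : Δ (d ∸ 2)) → ¬ (w (proj₁ f) x ≈ 0#))
    -- injective on ≈-classes
    × (∀ (f f' : VF d) → w (proj₁ f) ≗Δ w (proj₁ f') → f ≈VF f')
    -- surjective onto VF_{d-2}
    × (∀ (g : VF (d ∸ 2)) → Σ (VF d) (λ f → w (proj₁ f) ≗Δ proj₁ g))
lemma8p16 𝔽 (suc (suc e)) (s≤s (s≤s z≤n)) =
  w-respects-≈VF 𝔽 e , (λ f → w-nonzero 𝔽 (proj₁ f) (proj₂ f)) , w-injective 𝔽 e , w-surjective 𝔽 e
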